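{- Let $G$ be a connected graph of order at least three. If $\gamma(G-v)\ge\gamma(G)$ for every vertex $v$ that belongs to some $\gamma$-set of $G$, then $\gamma(G)=\gamma_{\rm cer}(G)$.
   Context: All graphs are finite and simple; $G-v$ denotes the graph obtained from $G$ by deleting the vertex $v$. A set $D\subseteq V_G$ is a dominating set of $G$ if every vertex of $V_G-D$ is adjacent to at least one vertex of $D$; $\gamma(G)$ is the minimum cardinality of a dominating set, and a $\gamma$-set is a dominating set of cardinality $\gamma(G)$. A set $D\subseteq V_G$ is a certified dominating set of $G$ if $D$ is a dominating set of $G$ and every vertex in $D$ has either zero or at least two neighbors in $V_G-D$; $\gamma_{\rm cer}(G)$ is the minimum cardinality of a certified dominating set of $G$. -}

module Defs where

open import Level using (0ℓ)
open import Data.Nat using (ℕ; suc; _≤_)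
open import Data.Fin using (Fin; punchIn)
open import Data.Fin.Subset using (Subset; _∈_; _∉_; ∣_∣)
open import Data.Product using (Σ; ∃; ∃-syntax; _×_; _,_)
open import Data.Sum using (_⊎_)
open import Relation.Nullary using (¬_)
open import Relation.Binary.PropositionalEquality using (_≡_; _≢_)

record Graph (n : ℕ) : Set₁ where
  field
    Adj     : Fin n → Fin n → Set
    sym     : ∀ {u v} → Adj u v → Adj v u
    irrefl  : ∀ {v} → ¬ Adj v v
open Graph public

_-ᵥ_ : ∀ {m} → Graph (suc m) → Fin (suc m) → Graph m
Adj    (G -ᵥ v) i j = Adj G (punchIn v i) (punchIn v j)
sym    (G -ᵥ v) p   = sym G p
irrefl (G -ᵥ v) p   = irrefl G p

data Walk {n} (G : Graph n) : Fin n → Fin n → Set where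
  here : ∀ {v} → Walk G v v
  step : ∀ {u w v} → Adj G u w → Walk G w v → Walk G u v

Connected : ∀ {n} → Graph n → Set
Connected G = ∀ u v → Walk G u v

Dominating : ∀ {n} → Graph n → Subset n → Set
Dominating G D = ∀ v → v ∉ D → ∃[ u ] (u ∈ D × Adj G u v)

Certified : ∀ {n} → Graph n → Subset n → Set
Certified G D =
  Dominating G D ×
  (∀ v → v ∈ D →
     (∀ u → Adj G v u → u ∈ D)
     ⊎ (∃[ u ] ∃[ w ] (u ≢ w × u ∉ D × w ∉ D × Adj G v u × Adj G v w)))

IsDomNumber : ∀ {n} → Graph n → ℕ → Set
IsDomNumber G k =
  (∃[ D ] (Dominating G D × ∣ D ∣ ≡ k)) × (∀ D → Dominating G D → k ≤ ∣ D ∣)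

IsGammaSet : ∀ {n} → Graph n → Subset n → Set
IsGammaSet G D = Dominating G D × (∀ D′ → Dominating G D′ → ∣ D ∣ ≤ ∣ D′ ∣)

IsCerDomNumber : ∀ {n} → Graph n → ℕ → Set
IsCerDomNumber G k =
  (∃[ D ] (Certified G D × ∣ D ∣ ≡ k)) × (∀ D → Certified G D → k ≤ ∣ D ∣)

module Submission where

-- Let D be a γ-set. Deleting a vertex of a γ-set never lowers γ, so no z ∈ D is redundant
-- (D − z never dominates G − z); hence every v ∈ D has a private neighbour u outside D.
-- If v has two of them it satisfies the certified condition. If u is the only one,
-- D′ = D − v + u is again a γ-set, and non-redundancy of v in D and of u in D′ shows that
-- neither u nor v has another neighbour in D. Since G is connected with at least three
-- vertices, some edge leaves {u, v}, and its far end y lies outside D: then v has the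
-- outside neighbours u, y in D, or u has v, y in D′. Vertices of D already satisfying the
-- condition keep it in D′, so handling the vertices one by one gives a certified γ-set.

open import Defs hiding (sym)
open import Data.Nat using (ℕ; zero; suc; _≤_; s≤s; s≤s⁻¹)
open import Data.Nat.Properties using (1+n≰n)
open import Data.Fin using (Fin; zero; suc; punchIn; punchOut) renaming (_≟_ to _≟ᶠ_)
open import Data.Fin.Properties using (punchInᵢ≢i; punchIn-punchOut; any?)
open import Data.Fin.Subset using (Subset; _∈_; _∉_; ∣_∣; inside; outside)
open import Data.Fin.Subset.Properties using (_∈?_)
open import Data.Vec using (Vec; []; _∷_; here; there; lookup; removeAt; insertAt; _[_]≔_)
open import Data.Vec.Properties
  using ([]=⇒lookup; lookup⇒[]=; insertAt-lookup; insertAt-punchIn; lookup∘update; lookup∘update′)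
open import Data.List using ([]; _∷_; allFin)
open import Data.List.Relation.Unary.All as All using (All; []; _∷_)
open import Data.List.Membership.Propositional.Properties using (∈-allFin)
open import Data.Product using (∃-syntax; _×_; _,_; proj₁; proj₂)
open import Data.Sum using (inj₁; inj₂; [_,_])
open import Data.Empty using (⊥-elim)
open import Relation.Nullary using (¬_; yes; no)
open import Relation.Nullary.Decidable using (_×-dec_; _⊎-dec_; ¬?)
open import Relation.Unary using (Decidable)
open import Function using (_∘_)
open import Relation.Binary.PropositionalEquality
  using (_≡_; _≢_; refl; sym; trans; cong; subst; subst₂; module ≡-Reasoning)

∈-transport : ∀ {n k} {x : Fin n} {y : Fin k} {p : Subset n} {q : Subset k} →
              lookup p x ≡ lookup q y → x ∈ p → y ∈ q
∈-transport {y = y} {q = q} e x∈p = lookup⇒[]= y q (trans (sym e) ([]=⇒lookup x∈p))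

∉⇒lookup≡outside : ∀ {n} {x : Fin n} {p : Subset n} → x ∉ p → lookup p x ≡ outside
∉⇒lookup≡outside {x = x} {p} x∉p with lookup p x in eq
... | inside  = ⊥-elim (x∉p (lookup⇒[]= x p eq))
... | outside = refl

lookup-removeAt : ∀ {a} {A : Set a} {m} (xs : Vec A (suc m)) i j →
                  lookup (removeAt xs i) j ≡ lookup xs (punchIn i j)
lookup-removeAt (x ∷ xs)     zero    j       = refl
lookup-removeAt (x ∷ y ∷ xs) (suc i) zero    = refl
lookup-removeAt (x ∷ y ∷ xs) (suc i) (suc j) = lookup-removeAt (y ∷ xs) i j

suc∣removeAt∣≡∣p∣ : ∀ {m} {p : Subset (suc m)} {z} → z ∈ p → suc ∣ removeAt p z ∣ ≡ ∣ p ∣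
suc∣removeAt∣≡∣p∣ here = refl
suc∣removeAt∣≡∣p∣ {p = inside  ∷ _ ∷ _} (there z∈p) = cong suc (suc∣removeAt∣≡∣p∣ z∈p)
suc∣removeAt∣≡∣p∣ {p = outside ∷ _ ∷ _} (there z∈p) = suc∣removeAt∣≡∣p∣ z∈p

∣insertAt-inside∣ : ∀ {m} (p : Subset m) z → ∣ insertAt p z inside ∣ ≡ suc ∣ p ∣
∣insertAt-inside∣ p              zero    = refl
∣insertAt-inside∣ (inside  ∷ p) (suc z) = cong suc (∣insertAt-inside∣ p z)
∣insertAt-inside∣ (outside ∷ p) (suc z) = ∣insertAt-inside∣ p z

suc∣p[z]≔outside∣≡∣p∣ : ∀ {m} {p : Subset m} {z} → z ∈ p → suc ∣ p [ z ]≔ outside ∣ ≡ ∣ p ∣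
suc∣p[z]≔outside∣≡∣p∣ here = refl
suc∣p[z]≔outside∣≡∣p∣ {p = inside  ∷ _} (there z∈p) = cong suc (suc∣p[z]≔outside∣≡∣p∣ z∈p)
suc∣p[z]≔outside∣≡∣p∣ {p = outside ∷ _} (there z∈p) = suc∣p[z]≔outside∣≡∣p∣ z∈p

∣p[z]≔inside∣≡suc∣p∣ : ∀ {m} (p : Subset m) z → lookup p z ≡ outside →
                        ∣ p [ z ]≔ inside ∣ ≡ suc ∣ p ∣
∣p[z]≔inside∣≡suc∣p∣ (outside ∷ p) zero    _ = refl
∣p[z]≔inside∣≡suc∣p∣ (inside  ∷ p) (suc z) e = cong suc (∣p[z]≔inside∣≡suc∣p∣ p z e)
∣p[z]≔inside∣≡suc∣p∣ (outside ∷ p) (suc z) e = ∣p[z]≔inside∣≡suc∣p∣ p z e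

∃-distinct-from-two : ∀ {m} → 2 ≤ m → (a b : Fin (suc m)) → ∃[ z ] (z ≢ a × z ≢ b)
∃-distinct-from-two {suc zero} (s≤s ()) a b
∃-distinct-from-two {suc (suc m)} _ a b with zero ≟ᶠ a | zero ≟ᶠ b
... | no 0≢a | no 0≢b = zero , 0≢a , 0≢b
... | yes refl | _ with suc zero ≟ᶠ b
...   | no 1≢b  = suc zero , (λ ()) , 1≢b
...   | yes refl = suc (suc zero) , (λ ()) , (λ ())
∃-distinct-from-two {suc (suc m)} _ a b | no _ | yes refl with suc zero ≟ᶠ a
...   | no 1≢a  = suc zero , 1≢a , (λ ())
...   | yes refl = suc (suc zero) , (λ ()) , (λ ())

walk-leaves : ∀ {n} {G : Graph n} {P : Fin n → Set} → Decidable P →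
              ∀ {a z} → Walk G a z → P a → ¬ P z → ∃[ x ] ∃[ y ] (P x × ¬ P y × Adj G x y)
walk-leaves P? here Pa ¬Pz = ⊥-elim (¬Pz Pa)
walk-leaves P? (step {w = w} a~w w⇝z) Pa ¬Pz with P? w
... | yes Pw  = walk-leaves P? w⇝z Pw ¬Pz
... | no ¬Pw = _ , w , Pa , ¬Pw , a~w

TwoOutside : ∀ {n} → Graph n → Subset n → Fin n → Set
TwoOutside G D v = ∃[ u ] ∃[ w ] (u ≢ w × u ∉ D × w ∉ D × Adj G v u × Adj G v w)

module _ {m} (G : Graph (suc m)) where

  Redundant : Subset (suc m) → Fin (suc m) → Set
  Redundant T z = ∀ x → x ≢ z → x ∉ T → ∃[ w ] (w ≢ z × w ∈ T × Adj G w x)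

  insertAt-dominating : ∀ z {E} → Dominating (G -ᵥ z) E → Dominating G (insertAt E z inside)
  insertAt-dominating z {E} domE x x∉E⁺ with z ≟ᶠ x
  ... | yes refl = ⊥-elim (x∉E⁺ (lookup⇒[]= z _ (insertAt-lookup E z inside)))
  ... | no z≢x with domE (punchOut z≢x) (λ j∈E → x∉E⁺ (∈-transport lookup-eq j∈E))
    where
    lookup-eq : lookup E (punchOut z≢x) ≡ lookup (insertAt E z inside) x
    lookup-eq = trans (sym (insertAt-punchIn E z inside _))
                      (cong (lookup (insertAt E z inside)) (punchIn-punchOut z≢x))
  ... | w , w∈E , w~x =
    punchIn z w , ∈-transport (sym (insertAt-punchIn E z inside w)) w∈E ,
    subst (Adj G (punchIn z w)) (punchIn-punchOut z≢x) w~x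

  removeAt-dominating : ∀ {T z} → Redundant T z → Dominating (G -ᵥ z) (removeAt T z)
  removeAt-dominating {T} {z} red j j∉S
    with red (punchIn z j) (punchInᵢ≢i z j) (j∉S ∘ ∈-transport (sym (lookup-removeAt T z j)))
  ... | w , w≢z , w∈T , w~x =
    punchOut z≢w , ∈-transport lookup-eq w∈T ,
    subst (λ t → Adj G t (punchIn z j)) (sym (punchIn-punchOut z≢w)) w~x
    where
    z≢w : z ≢ w
    z≢w z≡w = w≢z (sym z≡w)
    lookup-eq : lookup T w ≡ lookup (removeAt T z) (punchOut z≢w)
    lookup-eq = sym (trans (lookup-removeAt T z _) (cong (lookup T) (punchIn-punchOut z≢w)))

  removeAt-isDomNumber : ∀ {T z} → IsGammaSet G T → z ∈ T → Redundant T z →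
                         IsDomNumber (G -ᵥ z) ∣ removeAt T z ∣
  removeAt-isDomNumber {T} {z} (_ , minT) z∈T red =
    (removeAt T z , removeAt-dominating red , refl) ,
    λ E domE → s≤s⁻¹ (subst₂ _≤_ (sym (suc∣removeAt∣≡∣p∣ z∈T)) (∣insertAt-inside∣ E z)
                                 (minT _ (insertAt-dominating z domE)))

module Certification {m} (G : Graph (suc m)) (m≥2 : 2 ≤ m) (connected : Connected G)
  (g : ℕ) (γ-minimal : ∀ D → Dominating G D → g ≤ ∣ D ∣)
  (deletion-stable : ∀ v D → IsGammaSet G D → v ∈ D → ∀ k → IsDomNumber (G -ᵥ v) k → g ≤ k)
  where

  V : Set
  V = Fin (suc m)

  GammaSet : Subset (suc m) → Set
  GammaSet D = Dominating G D × ∣ D ∣ ≡ g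

  not-redundant : ∀ {D z} → GammaSet D → z ∈ D → ¬ Redundant G D z
  not-redundant {D} {z} (domD , ∣D∣≡g) z∈D red =
    1+n≰n (subst (_≤ ∣ removeAt D z ∣) (sym (trans (suc∣removeAt∣≡∣p∣ z∈D) ∣D∣≡g)) g≤∣D-z∣)
    where
    isGammaSet : IsGammaSet G D
    isGammaSet = domD , λ E domE → subst (_≤ ∣ E ∣) (sym ∣D∣≡g) (γ-minimal E domE)
    g≤∣D-z∣ : g ≤ ∣ removeAt D z ∣
    g≤∣D-z∣ = deletion-stable z D isGammaSet z∈D _ (removeAt-isDomNumber G isGammaSet z∈D red)

  CertifiedAt : Subset (suc m) → V → Set
  CertifiedAt D v = v ∈ D → TwoOutside G D v

  Improvement : Subset (suc m) → V → Set
  Improvement D v =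
    ∃[ D′ ] (GammaSet D′ × CertifiedAt D′ v × (∀ j → CertifiedAt D j → CertifiedAt D′ j))

  module Improve {D} (γD : GammaSet D) (v : V) (v∈D : v ∈ D) where

    dom : Dominating G D
    dom = proj₁ γD

    -- A fixed choice of dominating neighbour; "x is a private neighbour of v" is read
    -- as "dominator x ≡ v", which is decidable although adjacency is not.
    dominator : V → V
    dominator x with x ∈? D
    ... | yes _   = x
    ... | no x∉D = proj₁ (dom x x∉D)

    dominator-spec : ∀ x → x ∉ D → dominator x ∈ D × Adj G (dominator x) x
    dominator-spec x x∉D with x ∈? D
    ... | yes x∈D = ⊥-elim (x∉D x∈D)
    ... | no x∉D  = proj₂ (dom x x∉D)

    ∈≢∉ : ∀ {a b} → a ∈ D → b ∉ D → a ≢ b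
    ∈≢∉ a∈D b∉D refl = b∉D a∈D

    unchanged : TwoOutside G D v → Improvement D v
    unchanged two = D , γD , (λ _ → two) , λ _ cert → cert

    private-neighbour : ∃[ u ] (u ∉ D × dominator u ≡ v)
    private-neighbour with any? (λ x → ¬? (x ∈? D) ×-dec (dominator x ≟ᶠ v))
    ... | yes found = found
    ... | no none  = ⊥-elim (not-redundant γD v∈D λ x _ x∉D →
                       dominator x , (λ e → none (x , x∉D , e)) , dominator-spec x x∉D)

    v~private : ∀ {x} → x ∉ D → dominator x ≡ v → Adj G v x
    v~private {x} x∉D x↦v = subst (λ w → Adj G w x) x↦v (proj₂ (dominator-spec x x∉D))

    module Swap (u : V) (u∉D : u ∉ D) (u↦v : dominator u ≡ v)
                (unique : ∀ x → x ∉ D → x ≢ u → dominator x ≢ v) where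

      v≢u : v ≢ u
      v≢u = ∈≢∉ v∈D u∉D

      D′ : Subset (suc m)
      D′ = (D [ v ]≔ outside) [ u ]≔ inside

      lookup-D′ : ∀ {j} → j ≢ u → j ≢ v → lookup D′ j ≡ lookup D j
      lookup-D′ j≢u j≢v =
        trans (lookup∘update′ j≢u (D [ v ]≔ outside) inside) (lookup∘update′ j≢v D outside)

      u∈D′ : u ∈ D′
      u∈D′ = lookup⇒[]= u D′ (lookup∘update u (D [ v ]≔ outside) inside)

      v∉D′ : v ∉ D′
      v∉D′ v∈D′ with trans (sym ([]=⇒lookup v∈D′))
                           (trans (lookup∘update′ v≢u (D [ v ]≔ outside) inside)
                                  (lookup∘update v D outside))
      ... | ()

      ∈D⇒∈D′ : ∀ {j} → j ∈ D → j ≢ v → j ∈ D′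
      ∈D⇒∈D′ j∈D j≢v = ∈-transport (sym (lookup-D′ (∈≢∉ j∈D u∉D) j≢v)) j∈D

      ∈D′⇒∈D : ∀ {j} → j ∈ D′ → j ≢ u → j ∈ D
      ∈D′⇒∈D j∈D′ j≢u = ∈-transport (lookup-D′ j≢u λ { refl → v∉D′ j∈D′ }) j∈D′

      ∉D⇒∉D′ : ∀ {j} → j ∉ D → j ≢ u → j ∉ D′
      ∉D⇒∉D′ j∉D j≢u j∈D′ = j∉D (∈D′⇒∈D j∈D′ j≢u)

      ∉D′⇒∉D : ∀ {j} → j ∉ D′ → j ≢ v → j ∉ D
      ∉D′⇒∉D j∉D′ j≢v j∈D = j∉D′ (∈D⇒∈D′ j∈D j≢v)

      dominator-∈D′ : ∀ {x} → x ∉ D → x ≢ u → dominator x ∈ D′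
      dominator-∈D′ {x} x∉D x≢u = ∈D⇒∈D′ (proj₁ (dominator-spec x x∉D)) (unique x x∉D x≢u)

      dominating′ : Dominating G D′
      dominating′ x x∉D′ with x ≟ᶠ v | x ≟ᶠ u
      ... | yes refl | _        = u , u∈D′ , Graph.sym G (v~private u∉D u↦v)
      ... | no _     | yes refl = ⊥-elim (x∉D′ u∈D′)
      ... | no x≢v   | no x≢u   =
        dominator x , dominator-∈D′ x∉D x≢u , proj₂ (dominator-spec x x∉D)
        where
        x∉D : x ∉ D
        x∉D = ∉D′⇒∉D x∉D′ x≢v

      γD′ : GammaSet D′
      γD′ = dominating′ , (begin
        ∣ D′ ∣                     ≡⟨ ∣p[z]≔inside∣≡suc∣p∣ (D [ v ]≔ outside) u u∉D[v]≔outside ⟩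
        suc ∣ D [ v ]≔ outside ∣  ≡⟨ suc∣p[z]≔outside∣≡∣p∣ v∈D ⟩
        ∣ D ∣                      ≡⟨ proj₂ γD ⟩
        g                          ∎)
        where
        open ≡-Reasoning
        u∉D[v]≔outside : lookup (D [ v ]≔ outside) u ≡ outside
        u∉D[v]≔outside = trans (lookup∘update′ (λ u≡v → v≢u (sym u≡v)) D outside)
                               (∉⇒lookup≡outside u∉D)

      -- Otherwise u would be redundant in D′: v would be dominated by w.
      v-has-no-D-neighbour : ∀ w → w ∈ D → w ≢ v → ¬ Adj G w v
      v-has-no-D-neighbour w w∈D w≢v w~v = not-redundant γD′ u∈D′ redundant
        where
        redundant : Redundant G D′ u
        redundant x x≢u x∉D′ with x ≟ᶠ v
        ... | yes refl = w , ∈≢∉ w∈D u∉D , ∈D⇒∈D′ w∈D w≢v , w~v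
        ... | no x≢v   =
          dominator x , ∈≢∉ (proj₁ (dominator-spec x x∉D)) u∉D ,
          dominator-∈D′ x∉D x≢u , proj₂ (dominator-spec x x∉D)
          where
          x∉D : x ∉ D
          x∉D = ∉D′⇒∉D x∉D′ x≢v

      -- Otherwise v would be redundant in D: u would be dominated by w.
      u-has-no-D-neighbour : ∀ w → w ∈ D → w ≢ v → ¬ Adj G u w
      u-has-no-D-neighbour w w∈D w≢v u~w = not-redundant γD v∈D redundant
        where
        redundant : Redundant G D v
        redundant x x≢v x∉D with x ≟ᶠ u
        ... | yes refl = w , w≢v , w∈D , Graph.sym G u~w
        ... | no x≢u   = dominator x , unique x x∉D x≢u , dominator-spec x x∉D

      outside-preserved : ∀ {j} → j ∈ D → j ≢ v → TwoOutside G D j → TwoOutside G D′ j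
      outside-preserved {j} j∈D j≢v (a , b , a≢b , a∉D , b∉D , j~a , j~b) =
        a , b , a≢b , ∉D⇒∉D′ a∉D (not-u j~a) , ∉D⇒∉D′ b∉D (not-u j~b) , j~a , j~b
        where
        not-u : ∀ {c} → Adj G j c → c ≢ u
        not-u j~u refl = u-has-no-D-neighbour j j∈D j≢v (Graph.sym G j~u)

      -- Connectivity and n ≥ 3 give an edge from {u, v} to some y ∉ {u, v}; y ∉ D by the two
      -- lemmas above, so v (in D) or u (in D′) gains a second outside neighbour.
      improvement : Improvement D v
      improvement with ∃-distinct-from-two m≥2 u v
      ... | z , z≢u , z≢v
        with walk-leaves (λ x → (x ≟ᶠ u) ⊎-dec (x ≟ᶠ v)) (connected v z)
                         (inj₂ refl) [ z≢u , z≢v ]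
      ... | _ , y , inj₂ refl , y∉uv , v~y =
        unchanged (u , y , (λ u≡y → y≢u (sym u≡y)) , u∉D , y∉D , v~private u∉D u↦v , v~y)
        where
        y≢u : y ≢ u
        y≢u y≡u = y∉uv (inj₁ y≡u)
        y∉D : y ∉ D
        y∉D y∈D = v-has-no-D-neighbour y y∈D (λ y≡v → y∉uv (inj₂ y≡v)) (Graph.sym G v~y)
      ... | _ , y , inj₁ refl , y∉uv , u~y = D′ , γD′ , (λ v∈D′ → ⊥-elim (v∉D′ v∈D′)) , preserves
        where
        y≢u : y ≢ u
        y≢u y≡u = y∉uv (inj₁ y≡u)
        y≢v : y ≢ v
        y≢v y≡v = y∉uv (inj₂ y≡v)
        u-outside : TwoOutside G D′ u
        u-outside =
          v , y , (λ v≡y → y≢v (sym v≡y)) , v∉D′ ,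
          ∉D⇒∉D′ (λ y∈D → u-has-no-D-neighbour y y∈D y≢v u~y) y≢u ,
          Graph.sym G (v~private u∉D u↦v) , u~y
        preserves : ∀ j → CertifiedAt D j → CertifiedAt D′ j
        preserves j cert j∈D′ with j ≟ᶠ u
        ... | yes refl = u-outside
        ... | no j≢u   = outside-preserved j∈D (λ { refl → v∉D′ j∈D′ }) (cert j∈D)
          where
          j∈D : j ∈ D
          j∈D = ∈D′⇒∈D j∈D′ j≢u

    improvement : Improvement D v
    improvement with private-neighbour
    ... | u , u∉D , u↦v with any? (λ x → ¬? (x ∈? D) ×-dec ¬? (x ≟ᶠ u) ×-dec (dominator x ≟ᶠ v))
    ...   | yes (x , x∉D , x≢u , x↦v) =
      unchanged (u , x , (λ u≡x → x≢u (sym u≡x)) , u∉D , x∉D ,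
                 v~private u∉D u↦v , v~private x∉D x↦v)
    ...   | no none = Swap.improvement u u∉D u↦v λ x x∉D x≢u x↦v → none (x , x∉D , x≢u , x↦v)

  improve : ∀ {D} → GammaSet D → ∀ v → Improvement D v
  improve {D} γD v with v ∈? D
  ... | yes v∈D = Improve.improvement γD v v∈D
  ... | no v∉D  = D , γD , (λ v∈D → ⊥-elim (v∉D v∈D)) , λ _ cert → cert

  certify : ∀ {D₀} → GammaSet D₀ → ∀ vs → ∃[ D ] (GammaSet D × All (CertifiedAt D) vs)
  certify γD₀ []       = _ , γD₀ , []
  certify γD₀ (v ∷ vs) with certify γD₀ vs
  ... | D , γD , certs with improve γD v
  ...   | D′ , γD′ , cert-v , preserves = D′ , γD′ , cert-v ∷ All.map (λ {j} → preserves j) certs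

theorem2p6 : ∀ {m} (G : Graph (suc m)) → 2 ≤ m → Connected G →
    (∀ g → IsDomNumber G g → ∀ v D → IsGammaSet G D → v ∈ D →
      ∀ k → IsDomNumber (G -ᵥ v) k → g ≤ k) →
    ∀ g → IsDomNumber G g → IsCerDomNumber G g
theorem2p6 {m} G m≥2 connected stable g isDom@((D₀ , domD₀ , ∣D₀∣≡g) , γ-minimal)
  with Certification.certify G m≥2 connected g γ-minimal (stable g isDom)
                             (domD₀ , ∣D₀∣≡g) (allFin (suc m))
... | D , (domD , ∣D∣≡g) , certs =
  (D , (domD , λ v v∈D → inj₂ (All.lookup certs (∈-allFin v) v∈D)) , ∣D∣≡g) ,
  λ D′ certified → γ-minimal D′ (proj₁ certified)
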